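{- Let $m\geq 3$ and let $G=S(2^2,1^{m-2})$ be the starlike tree of order $m+3$ (the tree on vertices $o,x_1,\dots,x_m,y,z$ with edges $ox_1,\dots,ox_m,x_1y,x_2z$). Then $b(G)=\frac{m^2+m-4}{2}$.
   Context: All graphs are finite and simple. For vertices $u,v$ of a graph $G$, $d_G(u,v)$ is the length of a shortest $u$–$v$ path. For an edge $xy$ of $G$, $W^G_{xy}=\{u\in V(G): d_G(u,x)<d_G(u,y)\}$. A graph is distance-balanced if $|W^G_{xy}|=|W^G_{yx}|$ for every edge $xy$. For a graph $H$, $b(H)$ is the smallest number of edges which can be added to $H$ (keeping the vertex set) so that the resulting graph is distance-balanced. A starlike tree is a tree with exactly one vertex of degree greater than two; $S(n_1^{\alpha_1},\dots,n_k^{\alpha_k})$ denotes the starlike tree in which deleting the central vertex leaves $\alpha_i$ paths with $n_i$ vertices for each $i$. -}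

module Defs where

open import Data.Nat using (ℕ; zero; suc; _+_; _*_; _∸_; _<_; _≤_; _<?_; _≡ᵇ_; _≤ᵇ_)
open import Data.Nat.DivMod using (_/_)
open import Data.Bool using (Bool; true; false; _∧_; _∨_; not; if_then_else_; T)
open import Data.Fin using (Fin; toℕ; _≟_)
open import Data.Bool.ListAction using (any)
open import Data.List using (List; filter; length; allFin)
open import Relation.Nullary using (does)
open import Relation.Binary.PropositionalEquality using (_≡_; refl; cong; cong₂)

record Graph (n : ℕ) : Set where
  field
    adj   : Fin n → Fin n → Bool
    sym   : ∀ u v → adj u v ≡ adj v u
    irref : ∀ u → adj u u ≡ false
open Graph public

module _ {n : ℕ} (G : Graph n) where

  reach : ℕ → Fin n → Fin n → Bool
  reach zero    u v = does (u ≟ v)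
  reach (suc k) u v = reach k u v ∨ any (λ w → reach k u w ∧ adj G w v) (allFin n)

  search : Fin n → Fin n → ℕ → ℕ → ℕ
  search u v k zero       = k
  search u v k (suc fuel) = if reach k u v then k else search u v (suc k) fuel

  -- d_G(u,v): the length of a shortest u–v path.  (Distances in a connected
  -- graph on n vertices are < n; the value n is returned only if v is not
  -- reachable from u, which never happens for the connected graphs below.)
  dist : Fin n → Fin n → ℕ
  dist u v = search u v 0 n

  W-size : Fin n → Fin n → ℕ
  W-size x y = length (filter (λ u → dist u x <? dist u y) (allFin n))

  DistanceBalanced : Set
  DistanceBalanced = ∀ x y → T (adj G x y) → W-size x y ≡ W-size y x

  edgeCount : ℕ
  edgeCount = length (filter (λ p → toℕ (Data.Product.proj₁ p) <? toℕ (Data.Product.proj₂ p))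
                             (Data.List.filter (λ p → Data.Bool.Properties.T? (adj G (Data.Product.proj₁ p) (Data.Product.proj₂ p)))
                               (Data.List.cartesianProduct (allFin n) (allFin n))))
    where import Data.Product
          import Data.Bool.Properties

_⊑_ : {n : ℕ} → Graph n → Graph n → Set
G ⊑ H = ∀ u v → T (adj G u v) → T (adj H u v)

-- The starlike tree S(2^2, 1^(m-2)) on Fin (m + 3), labelled as
--   o = 0,  x_i = i (1 ≤ i ≤ m),  y = m+1,  z = m+2,
-- with edges o x_1, …, o x_m, x_1 y, x_2 z.
starEdge : ℕ → ℕ → ℕ → Bool
starEdge m a b =
     ((a ≡ᵇ 0) ∧ (1 ≤ᵇ b) ∧ (b ≤ᵇ m))
  ∨ ((a ≡ᵇ 1) ∧ (b ≡ᵇ suc m))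
  ∨ ((a ≡ᵇ 2) ∧ (b ≡ᵇ suc (suc m)))

≡ᵇ-sym : ∀ a b → (a ≡ᵇ b) ≡ (b ≡ᵇ a)
≡ᵇ-sym zero zero = refl
≡ᵇ-sym zero (suc b) = refl
≡ᵇ-sym (suc a) zero = refl
≡ᵇ-sym (suc a) (suc b) = ≡ᵇ-sym a b

≡ᵇ-refl : ∀ a → (a ≡ᵇ a) ≡ true
≡ᵇ-refl zero = refl
≡ᵇ-refl (suc a) = ≡ᵇ-refl a

starAdj : (m : ℕ) → Fin (m + 3) → Fin (m + 3) → Bool
starAdj m u v = (starEdge m (toℕ u) (toℕ v) ∨ starEdge m (toℕ v) (toℕ u))
                ∧ not (toℕ u ≡ᵇ toℕ v)
-- (the guard `u ≠ v` only matters for degenerate m < 3, where y or z would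
--  coincide with some x_i; for m ≥ 3 it changes nothing)

starSym : (m : ℕ) → ∀ u v → starAdj m u v ≡ starAdj m v u
starSym m u v = cong₂ _∧_
  (Data.Bool.Properties.∨-comm (starEdge m (toℕ u) (toℕ v)) (starEdge m (toℕ v) (toℕ u)))
  (cong not (≡ᵇ-sym (toℕ u) (toℕ v)))
  where import Data.Bool.Properties
        import Data.Nat.Properties

starIrref : (m : ℕ) → ∀ u → starAdj m u u ≡ false
starIrref m u rewrite ≡ᵇ-refl (toℕ u) =
  Data.Bool.Properties.∧-zeroʳ _
  where import Data.Nat.Properties
        import Data.Bool.Properties

starTree : (m : ℕ) → Graph (m + 3)
starTree m = record { adj = starAdj m ; sym = starSym m ; irref = starIrref m }

module Submission where

-- In a connected graph every vertex u satisfies |d(u,x) − d(u,y)| ≤ 1 for an edge xy, so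
-- Tr x + |W_xy| = Tr y + |W_yx|, where Tr v = Σ_u d(u,v) is the transmission: a connected graph
-- is distance-balanced iff adjacent vertices have equal transmission.  Weighing each vertex u by
-- d(u,v) + [u ~ v] + 2[u = v] ≥ 2 gives Tr v + deg v + 2 ≥ 2n, with equality when every vertex is
-- within distance 2 of v.
--
-- Lower bound: a distance-balanced H ⊇ S(2², 1^(m−2)) has constant transmission, since the tree is
-- connected.  The centre o is adjacent to the m vertices x_i and within distance 2 of everything,
-- so Tr o ≤ 2n − m − 2 (n = m + 3); hence deg v ≥ m for every v and 2|E(H)| ≥ (m + 3)m.
--
-- Upper bound: the complement of the 2-factor made of the triangle o y z and the m-cycle
-- x₁ x₂ … x_m is m-regular, contains the tree, and has diameter 2 (the x_i meet at o, and o, y, z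
-- meet at x₁), so its transmission is constant 2n − m − 2 and it has exactly (m + 3)m/2 edges.

open import Data.Bool using (Bool; true; false; _∧_; _∨_; not; T; if_then_else_)
open import Data.Bool.Properties using (T?; T-∨; T-∧; T-≡; ∧-comm; ∧-zeroʳ; ∨-identityʳ)
open import Data.Empty using (⊥-elim)
open import Data.Fin using (Fin; zero; suc; toℕ; fromℕ<; _≟_)
open import Data.Fin.Permutation using (Permutation′; permutation; _⟨$⟩ʳ_; _⟨$⟩ˡ_; inverseˡ; inverseʳ)
open import Data.Fin.Properties using (toℕ-injective; toℕ<n; toℕ-fromℕ<)
open import Data.List using (List; []; _∷_; _++_; map; filter; length; tabulate; allFin; cartesianProduct)
open import Data.List.Membership.Propositional using (lose)
open import Data.List.Membership.Propositional.Properties using (∈-allFin)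
open import Data.List.Properties using (filter-++; length-++; map-tabulate)
open import Data.List.Relation.Unary.Any using (satisfied)
open import Data.List.Relation.Unary.Any.Properties using (any⁺; any⁻)
open import Data.Nat
  using (ℕ; zero; suc; pred; _+_; _*_; _∸_; _≤_; _<_; _≡ᵇ_; _<ᵇ_; _≤ᵇ_; _<?_; z≤n; s≤s; ≤′-refl; ≤′-step)
open import Data.Nat.DivMod using (_/_; m/n*n≤m; m*n/n≡m)
open import Data.Nat.Properties hiding (_≟_)
open import Data.Nat.Properties using () renaming (_≟_ to _≟ℕ_)
open import Algebra.Properties.Semiring.Sum +-*-semiring
  using (sum; sum-syntax; sum-cong-≗; sum-replicate-zero; ∑-distrib-+; ∑-comm; *-distribˡ-sum)
open import Data.Nat.Tactic.RingSolver using (solve-∀)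
open import Data.Product using (Σ; ∃-syntax; _×_; _,_; proj₁; proj₂)
open import Data.Sum using (_⊎_; inj₁; inj₂)
open import Data.Unit using (tt)
open import Defs hiding (sym)
open import Function using (_∘_; id)
open import Function.Bundles using (Equivalence; _⇔_; mk⇔)
open import Relation.Binary.Definitions using (tri<; tri≈; tri>)
open import Relation.Binary.PropositionalEquality
open import Relation.Nullary using (Dec; yes; no; does; ¬_)
open import Relation.Nullary.Decidable using (dec-true; dec-false; does-⇔; decidable-stable)
open import Relation.Unary using (Pred; Decidable)
open import Relation.Unary.Properties using (_∩?_)

-- Indicators and finite sums

𝟙 : Bool → ℕ
𝟙 true  = 1
𝟙 false = 0

𝟙-mono : ∀ {p q} → (T p → T q) → 𝟙 p ≤ 𝟙 q
𝟙-mono {false}          _   = z≤n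
𝟙-mono {true}  {true}   _   = ≤-refl
𝟙-mono {true}  {false} p⇒q = ⊥-elim (p⇒q tt)

T-∨-false : ∀ {p} → T (p ∨ false) → T p
T-∨-false {true} _ = tt

𝟙-exclusive : ∀ {p q r} → (T p → ¬ T q) → (T p → ¬ T r) → (T q → ¬ T r) →
              𝟙 (not p ∧ not q ∧ not r) + 𝟙 p + 𝟙 q + 𝟙 r ≡ 1
𝟙-exclusive {true}  {true}          p⇒¬q _    _    = ⊥-elim (p⇒¬q tt tt)
𝟙-exclusive {true}  {false} {true}  _    p⇒¬r _    = ⊥-elim (p⇒¬r tt tt)
𝟙-exclusive {true}  {false} {false} _    _    _    = refl
𝟙-exclusive {false} {true}  {true}  _    _    q⇒¬r = ⊥-elim (q⇒¬r tt tt)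
𝟙-exclusive {false} {true}  {false} _    _    _    = refl
𝟙-exclusive {false} {false} {true}  _    _    _    = refl
𝟙-exclusive {false} {false} {false} _    _    _    = refl

+-𝟙-<ᵇ-swap : ∀ {a b} → a ≤ suc b → b ≤ suc a → a + 𝟙 (a <ᵇ b) ≡ b + 𝟙 (b <ᵇ a)
+-𝟙-<ᵇ-swap {zero}        {zero}        _         _         = refl
+-𝟙-<ᵇ-swap {zero}        {suc zero}    _         _         = refl
+-𝟙-<ᵇ-swap {suc zero}    {zero}        _         _         = refl
+-𝟙-<ᵇ-swap {suc a}       {suc b}       (s≤s a≤b) (s≤s b≤a) = cong suc (+-𝟙-<ᵇ-swap a≤b b≤a)
+-𝟙-<ᵇ-swap {zero}        {suc (suc b)} _         (s≤s ())
+-𝟙-<ᵇ-swap {suc (suc a)} {zero}        (s≤s ())  _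

𝟙-<ᵇ-trichotomy : ∀ {a b} → a ≢ b → 𝟙 (a <ᵇ b) + 𝟙 (b <ᵇ a) ≡ 1
𝟙-<ᵇ-trichotomy {zero}  {zero}  a≢b = ⊥-elim (a≢b refl)
𝟙-<ᵇ-trichotomy {zero}  {suc b} _   = refl
𝟙-<ᵇ-trichotomy {suc a} {zero}  _   = refl
𝟙-<ᵇ-trichotomy {suc a} {suc b} a≢b = 𝟙-<ᵇ-trichotomy (a≢b ∘ cong suc)

∑-const : ∀ n c → ∑[ i < n ] c ≡ n * c
∑-const zero    c = refl
∑-const (suc n) c = cong (c +_) (∑-const n c)

∑-zero : ∀ {n} {f : Fin n → ℕ} → (∀ i → f i ≡ 0) → sum f ≡ 0
∑-zero {n} f≡0 = trans (sum-cong-≗ f≡0) (sum-replicate-zero n)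

∑-mono-≤ : ∀ {n} {f g : Fin n → ℕ} → (∀ i → f i ≤ g i) → sum f ≤ sum g
∑-mono-≤ {zero}  f≤g = z≤n
∑-mono-≤ {suc n} f≤g = +-mono-≤ (f≤g zero) (∑-mono-≤ (f≤g ∘ suc))

∑-𝟙-≟ : ∀ {n} (v : Fin n) → ∑[ u < n ] 𝟙 (does (u ≟ v)) ≡ 1
∑-𝟙-≟ {suc n} zero    = cong suc (sum-replicate-zero n)
∑-𝟙-≟ {suc n} (suc v) = ∑-𝟙-≟ v

∑-𝟙-≡ᵇ : ∀ {n} c → c < n → ∑[ u < n ] 𝟙 (toℕ u ≡ᵇ c) ≡ 1
∑-𝟙-≡ᵇ {suc n} zero    _         = cong suc (sum-replicate-zero n)
∑-𝟙-≡ᵇ {suc n} (suc c) (s≤s c<n) = ∑-𝟙-≡ᵇ c c<n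

∑-𝟙-<ᵇ : ∀ {n} c → c ≤ n → ∑[ u < n ] 𝟙 (toℕ u <ᵇ c) ≡ c
∑-𝟙-<ᵇ {n}     zero    _         = sum-replicate-zero n
∑-𝟙-<ᵇ {suc n} (suc c) (s≤s c≤n) = cong suc (∑-𝟙-<ᵇ c c≤n)

module _ {a p} {A : Set a} {P : Pred A p} (P? : Decidable P) where

  length-filter-tabulate : ∀ {n} (f : Fin n → A) →
    length (filter P? (tabulate f)) ≡ ∑[ i < n ] 𝟙 (does (P? (f i)))
  length-filter-tabulate {zero}  f = refl
  length-filter-tabulate {suc n} f with does (P? (f zero))
  ... | true  = cong suc (length-filter-tabulate (f ∘ suc))
  ... | false = length-filter-tabulate (f ∘ suc)

  filter-filter : ∀ {q} {Q : Pred A q} (Q? : Decidable Q) xs →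
    filter Q? (filter P? xs) ≡ filter (P? ∩? Q?) xs
  filter-filter Q? [] = refl
  filter-filter Q? (x ∷ xs) with does (P? x)
  ... | false = filter-filter Q? xs
  ... | true with does (Q? x)
  ...   | true  = cong (x ∷_) (filter-filter Q? xs)
  ...   | false = filter-filter Q? xs

length-filter-cartesianProduct : ∀ {a b p} {A : Set a} {B : Set b} {P : Pred (A × B) p}
  (P? : Decidable P) {m n} (f : Fin m → A) (g : Fin n → B) →
  length (filter P? (cartesianProduct (tabulate f) (tabulate g)))
    ≡ ∑[ i < m ] ∑[ j < n ] 𝟙 (does (P? (f i , g j)))
length-filter-cartesianProduct P? {zero}  f g = refl
length-filter-cartesianProduct {A = A} {B = B} P? {suc m} f g = begin
  length (filter P? (map (f zero ,_) (tabulate g) ++ rest))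
    ≡⟨ cong length (filter-++ P? (map (f zero ,_) (tabulate g)) rest) ⟩
  length (filter P? (map (f zero ,_) (tabulate g)) ++ filter P? rest)
    ≡⟨ length-++ (filter P? (map (f zero ,_) (tabulate g))) ⟩
  length (filter P? (map (f zero ,_) (tabulate g))) + length (filter P? rest)
    ≡⟨ cong₂ _+_ (cong (length ∘ filter P?) (map-tabulate g (f zero ,_)))
                 (length-filter-cartesianProduct P? (f ∘ suc) g) ⟩
  length (filter P? (tabulate ((f zero ,_) ∘ g))) + _
    ≡⟨ cong (_+ _) (length-filter-tabulate P? ((f zero ,_) ∘ g)) ⟩
  _ ∎
  where
  open ≡-Reasoning
  rest : List (A × B)
  rest = cartesianProduct (tabulate (f ∘ suc)) (tabulate g)

-- Walks, distances and transmission

module Walks {n} (G : Graph n) where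

  Adj : Fin n → Fin n → Set
  Adj u v = T (adj G u v)

  -- A record rather than T (reach G k u v), so that k, u and v can be inferred.
  record Reach (k : ℕ) (u v : Fin n) : Set where
    constructor reached
    field reaches : T (reach G k u v)
  open Reach public

  Connected : Set
  Connected = ∀ u v → Reach n u v

  adj-sym : ∀ {u v} → Adj u v → Adj v u
  adj-sym {u} {v} = subst T (Graph.sym G u v)

  adj⇒≢ : ∀ {u v} → Adj u v → u ≢ v
  adj⇒≢ {u} a refl = subst T (Graph.irref G u) a

  reach-refl : ∀ u → Reach 0 u u
  reach-refl u = reached (subst T (sym (dec-true (u ≟ u) refl)) tt)

  reach-zero⁻¹ : ∀ {u v} → Reach 0 u v → u ≡ v
  reach-zero⁻¹ {u} {v} (reached r) with u ≟ v
  ... | yes u≡v = u≡v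

  reach-weaken : ∀ {k u v} → Reach k u v → Reach (suc k) u v
  reach-weaken (reached r) = reached (Equivalence.from T-∨ (inj₁ r))

  reach-snoc : ∀ {k u w v} → Reach k u w → Adj w v → Reach (suc k) u v
  reach-snoc {k} {u} {w} {v} (reached r) a = reached (Equivalence.from (T-∨ {reach G k u v}) (inj₂
    (any⁺ (λ w′ → reach G k u w′ ∧ adj G w′ v) (lose (∈-allFin w) (Equivalence.from T-∧ (r , a))))))

  reach-suc⁻¹ : ∀ {k u v} → Reach (suc k) u v → Reach k u v ⊎ ∃[ w ] Reach k u w × Adj w v
  reach-suc⁻¹ {k} {u} {v} (reached r) with Equivalence.to (T-∨ {reach G k u v}) r
  ... | inj₁ r′ = inj₁ (reached r′)
  ... | inj₂ r′ with satisfied (any⁻ (λ w → reach G k u w ∧ adj G w v) (allFin n) r′)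
  ...   | w , t with Equivalence.to T-∧ t
  ...     | r″ , a = inj₂ (w , reached r″ , a)

  reach-mono : ∀ {k j u v} → k ≤ j → Reach k u v → Reach j u v
  reach-mono {k} {j} k≤j r with ≤⇒≤′ k≤j
  ... | ≤′-refl       = r
  ... | ≤′-step k≤′j′ = reach-weaken (reach-mono (≤′⇒≤ k≤′j′) r)

  reach-one⁻¹ : ∀ {u v} → Reach 1 u v → u ≡ v ⊎ Adj u v
  reach-one⁻¹ r with reach-suc⁻¹ r
  ... | inj₁ r₀ = inj₁ (reach-zero⁻¹ r₀)
  ... | inj₂ (w , r₀ , a) with reach-zero⁻¹ r₀
  ...   | refl = inj₂ a

  reach-trans : ∀ {i j u w v} → Reach i u w → Reach j w v → Reach (i + j) u v
  reach-trans {i} {zero} r s with reach-zero⁻¹ s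
  ... | refl = subst (λ k → Reach k _ _) (sym (+-identityʳ i)) r
  reach-trans {i} {suc j} {u} {w} {v} r s = subst (λ k → Reach k u v) (sym (+-suc i j)) (step (reach-suc⁻¹ s))
    where
    step : Reach j w v ⊎ ∃[ w′ ] Reach j w w′ × Adj w′ v → Reach (suc (i + j)) u v
    step (inj₁ s′)            = reach-weaken (reach-trans r s′)
    step (inj₂ (w′ , s′ , a)) = reach-snoc (reach-trans r s′) a

  reach-sym : ∀ {k u v} → Reach k u v → Reach k v u
  reach-sym {zero} r with reach-zero⁻¹ r
  ... | refl = r
  reach-sym {suc k} r with reach-suc⁻¹ r
  ... | inj₁ r′           = reach-weaken (reach-sym r′)
  ... | inj₂ (w , r′ , a) = reach-trans (reach-snoc (reach-refl _) (adj-sym a)) (reach-sym r′)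

reach-⊑ : ∀ {n} {G H : Graph n} → G ⊑ H → ∀ {k u v} → Walks.Reach G k u v → Walks.Reach H k u v
reach-⊑ {G = G} {H} G⊑H {zero} (Walks.reached r) = Walks.reached r
reach-⊑ {G = G} {H} G⊑H {suc k} r with Walks.reach-suc⁻¹ G r
... | inj₁ r′           = Walks.reach-weaken H (reach-⊑ G⊑H r′)
... | inj₂ (w , r′ , a) = Walks.reach-snoc H (reach-⊑ G⊑H r′) (G⊑H w _ a)

module Distance {n} (G : Graph n) where

  open Walks G

  d : Fin n → Fin n → ℕ
  d = dist G

  search-≤ : ∀ {j u v} k fuel → Reach j u v → k ≤ j → search G u v k fuel ≤ j
  search-≤         k zero        r k≤j = k≤j
  search-≤ {u = u} {v} k (suc fuel) r k≤j with reach G k u v in eq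
  ... | true  = k≤j
  ... | false = search-≤ (suc k) fuel r (≤∧≢⇒< k≤j λ { refl → subst T eq (reaches r) })

  search-reach : ∀ {u v} k fuel → Reach (k + fuel) u v → Reach (search G u v k fuel) u v
  search-reach {u} {v} k zero       r = subst (λ j → Reach j u v) (+-identityʳ k) r
  search-reach {u} {v} k (suc fuel) r with reach G k u v in eq
  ... | true  = reached (subst T (sym eq) tt)
  ... | false = search-reach (suc k) fuel (subst (λ j → Reach j u v) (+-suc k fuel) r)

  dist-≤ : ∀ {k u v} → Reach k u v → d u v ≤ k
  dist-≤ r = search-≤ 0 n r z≤n

  dist-reach : Connected → ∀ u v → Reach (d u v) u v
  dist-reach conn u v = search-reach 0 n (conn u v)

  dist-self : ∀ u → d u u ≡ 0
  dist-self u = n≤0⇒n≡0 (dist-≤ (reach-refl u))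

  dist-adj : ∀ {u v} → Adj u v → d u v ≤ 1
  dist-adj a = dist-≤ (reach-snoc (reach-refl _) a)

  dist-edge : Connected → ∀ {x y} → Adj x y → ∀ u → d u y ≤ suc (d u x)
  dist-edge conn {x} a u = dist-≤ (reach-snoc (dist-reach conn u x) a)

  dist-pos : Connected → ∀ {u v} → u ≢ v → 1 ≤ d u v
  dist-pos conn {u} {v} u≢v with d u v | dist-reach conn u v
  ... | zero  | r = ⊥-elim (u≢v (reach-zero⁻¹ r))
  ... | suc _ | _ = s≤s z≤n

  dist-nonadj : Connected → ∀ {u v} → u ≢ v → ¬ Adj u v → 2 ≤ d u v
  dist-nonadj conn {u} {v} u≢v ¬a with d u v | dist-reach conn u v
  ... | zero        | r = ⊥-elim (u≢v (reach-zero⁻¹ r))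
  ... | suc (suc _) | _ = s≤s (s≤s z≤n)
  ... | suc zero    | r with reach-one⁻¹ r
  ...   | inj₁ u≡v = ⊥-elim (u≢v u≡v)
  ...   | inj₂ a   = ⊥-elim (¬a a)

  Tr : Fin n → ℕ
  Tr x = ∑[ u < n ] d u x

  deg : Fin n → ℕ
  deg v = ∑[ u < n ] 𝟙 (adj G v u)

  W-size≡∑ : ∀ x y → W-size G x y ≡ ∑[ u < n ] 𝟙 (d u x <ᵇ d u y)
  W-size≡∑ x y = length-filter-tabulate (λ u → d u x <? d u y) id

  transmission-W : Connected → ∀ {x y} → Adj x y → Tr x + W-size G x y ≡ Tr y + W-size G y x
  transmission-W conn {x} {y} a = begin
    Tr x + W-size G x y                      ≡⟨ cong (Tr x +_) (W-size≡∑ x y) ⟩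
    Tr x + ∑[ u < n ] 𝟙 (d u x <ᵇ d u y)     ≡⟨ ∑-distrib-+ (λ u → d u x) _ ⟨
    ∑[ u < n ] (d u x + 𝟙 (d u x <ᵇ d u y))  ≡⟨ sum-cong-≗ swap ⟩
    ∑[ u < n ] (d u y + 𝟙 (d u y <ᵇ d u x))  ≡⟨ ∑-distrib-+ (λ u → d u y) _ ⟩
    Tr y + ∑[ u < n ] 𝟙 (d u y <ᵇ d u x)     ≡⟨ cong (Tr y +_) (W-size≡∑ y x) ⟨
    Tr y + W-size G y x                      ∎
    where
    open ≡-Reasoning
    swap : ∀ u → d u x + 𝟙 (d u x <ᵇ d u y) ≡ d u y + 𝟙 (d u y <ᵇ d u x)
    swap u = +-𝟙-<ᵇ-swap (dist-edge conn (adj-sym a) u) (dist-edge conn a u)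

  balanced⇒transmission≡ : Connected → ∀ {x y} → Adj x y → W-size G x y ≡ W-size G y x → Tr x ≡ Tr y
  balanced⇒transmission≡ conn {x} {y} a eq =
    +-cancelʳ-≡ (W-size G x y) (Tr x) (Tr y) (trans (transmission-W conn a) (cong (Tr y +_) (sym eq)))

  transmission≡⇒balanced : Connected → ∀ {x y} → Adj x y → Tr x ≡ Tr y → W-size G x y ≡ W-size G y x
  transmission≡⇒balanced conn {x} {y} a eq =
    +-cancelˡ-≡ (Tr x) (W-size G x y) (W-size G y x)
      (trans (transmission-W conn a) (cong (_+ W-size G y x) (sym eq)))

  private
    distance-profile : Fin n → Fin n → ℕ
    distance-profile v u = d u v + 𝟙 (adj G v u) + 2 * 𝟙 (does (u ≟ v))

    ∑-distance-profile : ∀ v → ∑[ u < n ] distance-profile v u ≡ Tr v + deg v + 2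
    ∑-distance-profile v = begin
      ∑[ u < n ] (d u v + 𝟙 (adj G v u) + 2 * 𝟙 (does (u ≟ v)))
        ≡⟨ ∑-distrib-+ (λ u → d u v + 𝟙 (adj G v u)) _ ⟩
      ∑[ u < n ] (d u v + 𝟙 (adj G v u)) + ∑[ u < n ] (2 * 𝟙 (does (u ≟ v)))
        ≡⟨ cong₂ _+_ (∑-distrib-+ (λ u → d u v) (λ u → 𝟙 (adj G v u)))
                     (sym (*-distribˡ-sum 2 (λ u → 𝟙 (does (u ≟ v))))) ⟩
      Tr v + deg v + 2 * ∑[ u < n ] 𝟙 (does (u ≟ v))
        ≡⟨ cong (λ k → Tr v + deg v + 2 * k) (∑-𝟙-≟ v) ⟩
      Tr v + deg v + 2 ∎
      where open ≡-Reasoning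

  transmission-lower : Connected → ∀ v → 2 * n ≤ Tr v + deg v + 2
  transmission-lower conn v = begin
    2 * n                               ≡⟨ *-comm 2 n ⟩
    n * 2                               ≡⟨ ∑-const n 2 ⟨
    ∑[ u < n ] 2                        ≤⟨ ∑-mono-≤ profile≥2 ⟩
    ∑[ u < n ] distance-profile v u     ≡⟨ ∑-distance-profile v ⟩
    Tr v + deg v + 2                    ∎
    where
    open ≤-Reasoning
    profile≥2 : ∀ u → 2 ≤ distance-profile v u
    profile≥2 u with u ≟ v
    ... | yes _   = m≤n+m 2 _
    ... | no u≢v with adj G v u in e
    ...   | true  = ≤-trans (s≤s (dist-pos conn u≢v))
                            (≤-reflexive (sym (trans (+-identityʳ _) (+-comm (d u v) 1))))
    ...   | false = ≤-trans (dist-nonadj conn u≢v (λ a → subst T e (adj-sym a)))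
                            (≤-reflexive (sym (trans (+-identityʳ _) (+-identityʳ _))))

  transmission-upper : ∀ v → (∀ u → Reach 2 u v) → Tr v + deg v + 2 ≤ 2 * n
  transmission-upper v r₂ = begin
    Tr v + deg v + 2                    ≡⟨ ∑-distance-profile v ⟨
    ∑[ u < n ] distance-profile v u     ≤⟨ ∑-mono-≤ profile≤2 ⟩
    ∑[ u < n ] 2                        ≡⟨ ∑-const n 2 ⟩
    n * 2                               ≡⟨ *-comm n 2 ⟩
    2 * n                               ∎
    where
    open ≤-Reasoning
    profile≤2 : ∀ u → distance-profile v u ≤ 2
    profile≤2 u with u ≟ v
    ... | yes refl rewrite dist-self u | Graph.irref G u = ≤-refl
    ... | no _ with adj G v u in e
    ...   | true  = ≤-trans (≤-reflexive (trans (+-identityʳ _) (+-comm (d u v) 1)))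
                            (s≤s (dist-adj (adj-sym (subst T (sym e) tt))))
    ...   | false = ≤-trans (≤-reflexive (trans (+-identityʳ _) (+-identityʳ _))) (dist-≤ (r₂ u))

  edgeCount≡∑ : edgeCount G ≡ ∑[ u < n ] ∑[ v < n ] 𝟙 (adj G u v ∧ (toℕ u <ᵇ toℕ v))
  edgeCount≡∑ = trans (cong length (filter-filter adjacent? ordered? pairs))
                      (length-filter-cartesianProduct (adjacent? ∩? ordered?) id id)
    where
    pairs : List (Fin n × Fin n)
    pairs = cartesianProduct (allFin n) (allFin n)
    adjacent? : (p : Fin n × Fin n) → Dec (T (adj G (proj₁ p) (proj₂ p)))
    adjacent? p = T? (adj G (proj₁ p) (proj₂ p))
    ordered? : (p : Fin n × Fin n) → Dec (toℕ (proj₁ p) < toℕ (proj₂ p))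
    ordered? p = toℕ (proj₁ p) <? toℕ (proj₂ p)

  handshake : 2 * edgeCount G ≡ ∑[ v < n ] deg v
  handshake = begin
    2 * edgeCount G                  ≡⟨ cong (λ e → e + (e + 0)) edgeCount≡∑ ⟩
    E + (E + 0)                      ≡⟨ cong (E +_) (+-identityʳ E) ⟩
    E + E                            ≡⟨ cong (E +_) (∑-comm oriented) ⟩
    E + ∑[ u < n ] ∑[ v < n ] oriented v u
                                     ≡⟨ ∑-distrib-+ (λ u → ∑[ v < n ] oriented u v) _ ⟨
    ∑[ u < n ] (∑[ v < n ] oriented u v + ∑[ v < n ] oriented v u)
                                     ≡⟨ sum-cong-≗ (λ u → ∑-distrib-+ (oriented u) (λ v → oriented v u)) ⟨
    ∑[ u < n ] ∑[ v < n ] (oriented u v + oriented v u)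
                                     ≡⟨ sum-cong-≗ (λ u → sum-cong-≗ (λ v → split u v)) ⟨
    ∑[ u < n ] deg u                 ∎
    where
    open ≡-Reasoning
    oriented : Fin n → Fin n → ℕ
    oriented u v = 𝟙 (adj G u v ∧ (toℕ u <ᵇ toℕ v))
    E : ℕ
    E = ∑[ u < n ] ∑[ v < n ] oriented u v
    split : ∀ u v → 𝟙 (adj G u v) ≡ oriented u v + oriented v u
    split u v rewrite Graph.sym G v u with adj G u v in e
    ... | false = refl
    ... | true  = sym (𝟙-<ᵇ-trichotomy (adj⇒≢ (subst T (sym e) tt) ∘ toℕ-injective))

module _ {n} {G H : Graph n} (G⊑H : G ⊑ H) (connected : Walks.Connected H)
         (balanced : DistanceBalanced H) where
  open Walks G
  open Distance H using (Tr; balanced⇒transmission≡)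

  transmission-constant : ∀ {k u v} → Reach k u v → Tr u ≡ Tr v
  transmission-constant {zero} r = cong Tr (reach-zero⁻¹ r)
  transmission-constant {suc k} {v = v} r with reach-suc⁻¹ r
  ... | inj₁ r′             = transmission-constant r′
  ... | inj₂ (w , r′ , w~v) =
    trans (transmission-constant r′) (balanced⇒transmission≡ connected H-edge (balanced w v H-edge))
    where
    H-edge : Walks.Adj H w v
    H-edge = G⊑H w v w~v

module _ {n} (G : Graph n) where
  open Walks G
  open Distance G

  diameter-two-regular⇒balanced : ∀ {r} → 2 ≤ n → (∀ u v → Reach 2 u v) → (∀ v → deg v ≡ r) →
                                   DistanceBalanced G
  diameter-two-regular⇒balanced {r} 2≤n diam regular x y x~y =
    transmission≡⇒balanced connected x~y
      (+-cancelʳ-≡ r (Tr x) (Tr y) (+-cancelʳ-≡ 2 _ _ (trans (Tr+r+2 x) (sym (Tr+r+2 y)))))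
    where
    connected : Connected
    connected u v = reach-mono 2≤n (diam u v)
    Tr+r+2 : ∀ v → Tr v + r + 2 ≡ 2 * n
    Tr+r+2 v = subst (λ k → Tr v + k + 2 ≡ 2 * n) (regular v)
      (≤-antisym (transmission-upper v (λ u → diam u v)) (transmission-lower connected v))

-- The complement of the cycle graph of a permutation

module PermutationComplement {n} (π : Permutation′ n) (no-fixed-point : ∀ a → π ⟨$⟩ʳ a ≢ a)
                             (no-2-cycle : ∀ a → π ⟨$⟩ʳ a ≢ π ⟨$⟩ˡ a) where

  σ σ⁻¹ : Fin n → Fin n
  σ   = π ⟨$⟩ʳ_
  σ⁻¹ = π ⟨$⟩ˡ_

  ≡σ⇔σ⁻¹≡ : ∀ {a b} → b ≡ σ a ⇔ a ≡ σ⁻¹ b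
  ≡σ⇔σ⁻¹≡ {a} {b} = mk⇔ (λ { refl → sym (inverseˡ π) }) (λ { refl → sym (inverseʳ π) })

  ≡σ⁻¹⇔σ≡ : ∀ {a b} → b ≡ σ⁻¹ a ⇔ a ≡ σ b
  ≡σ⁻¹⇔σ≡ {a} {b} = mk⇔ (λ { refl → sym (inverseʳ π) }) (λ { refl → sym (inverseˡ π) })

  complementAdj : Fin n → Fin n → Bool
  complementAdj a b = not (does (b ≟ a)) ∧ not (does (b ≟ σ a)) ∧ not (does (b ≟ σ⁻¹ a))

  complementAdj-sym : ∀ a b → complementAdj a b ≡ complementAdj b a
  complementAdj-sym a b = cong₂ (λ p q → not p ∧ q) (does-⇔ (mk⇔ sym sym) (b ≟ a) (a ≟ b)) (begin
    not (does (b ≟ σ a)) ∧ not (does (b ≟ σ⁻¹ a))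
      ≡⟨ cong₂ (λ p q → not p ∧ not q) (does-⇔ ≡σ⇔σ⁻¹≡ (b ≟ σ a) (a ≟ σ⁻¹ b))
                                        (does-⇔ ≡σ⁻¹⇔σ≡ (b ≟ σ⁻¹ a) (a ≟ σ b)) ⟩
    not (does (a ≟ σ⁻¹ b)) ∧ not (does (a ≟ σ b))
      ≡⟨ ∧-comm (not (does (a ≟ σ⁻¹ b))) _ ⟩
    not (does (a ≟ σ b)) ∧ not (does (a ≟ σ⁻¹ b)) ∎)
    where open ≡-Reasoning

  complement : Graph n
  complement = record
    { adj   = complementAdj
    ; sym   = complementAdj-sym
    ; irref = λ a → cong (λ p → not p ∧ not (does (a ≟ σ a)) ∧ not (does (a ≟ σ⁻¹ a)))
                         (dec-true (a ≟ a) refl)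
    }

  open Walks complement
  open Distance complement using (deg)

  -- The adjacency test is unfolded in the hypothesis so that `with` can abstract over its three parts.
  non-adjacent : ∀ {a b} → ¬ T (not (does (b ≟ a)) ∧ not (does (b ≟ σ a)) ∧ not (does (b ≟ σ⁻¹ a))) →
                 b ≡ a ⊎ b ≡ σ a ⊎ b ≡ σ⁻¹ a
  non-adjacent {a} {b} ¬a~b with b ≟ a | b ≟ σ a | b ≟ σ⁻¹ a
  ... | yes b≡a | _        | _         = inj₁ b≡a
  ... | no _    | yes b≡σa | _         = inj₂ (inj₁ b≡σa)
  ... | no _    | no _     | yes b≡σ⁻¹a = inj₂ (inj₂ b≡σ⁻¹a)
  ... | no _    | no _     | no _      = ⊥-elim (¬a~b tt)

  private
    σ⁻¹a≢a : ∀ a → σ⁻¹ a ≢ a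
    σ⁻¹a≢a a eq = no-fixed-point a (trans (cong σ (sym eq)) (inverseʳ π))

    T-does : ∀ {p} {P : Set p} (p? : Dec P) → T (does p?) → P
    T-does (yes p) _ = p

    δ : Fin n → Fin n → ℕ
    δ b c = 𝟙 (does (b ≟ c))

    partition : ∀ a b → 𝟙 (complementAdj a b) + δ b a + δ b (σ a) + δ b (σ⁻¹ a) ≡ 1
    partition a b = 𝟙-exclusive
      (λ p q → no-fixed-point a (trans (sym (T-does (b ≟ σ a) q)) (T-does (b ≟ a) p)))
      (λ p r → σ⁻¹a≢a a (trans (sym (T-does (b ≟ σ⁻¹ a) r)) (T-does (b ≟ a) p)))
      (λ q r → no-2-cycle a (trans (sym (T-does (b ≟ σ a) q)) (T-does (b ≟ σ⁻¹ a) r)))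

  deg-complement : ∀ a → deg a + 3 ≡ n
  deg-complement a = begin
    deg a + 3
      ≡⟨ trans (+-assoc (deg a + 1) 1 1) (+-assoc (deg a) 1 2) ⟨
    deg a + 1 + 1 + 1
      ≡⟨ cong₂ _+_ (cong₂ _+_ (cong (deg a +_) (∑-𝟙-≟ a)) (∑-𝟙-≟ (σ a))) (∑-𝟙-≟ (σ⁻¹ a)) ⟨
    deg a + ∑[ b < n ] δ b a + ∑[ b < n ] δ b (σ a) + ∑[ b < n ] δ b (σ⁻¹ a)
      ≡⟨ cong (λ s → s + ∑[ b < n ] δ b (σ a) + ∑[ b < n ] δ b (σ⁻¹ a)) (∑-distrib-+ (adj′ a) (λ b → δ b a)) ⟨
    ∑[ b < n ] (adj′ a b + δ b a) + ∑[ b < n ] δ b (σ a) + ∑[ b < n ] δ b (σ⁻¹ a)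
      ≡⟨ cong (_+ ∑[ b < n ] δ b (σ⁻¹ a)) (∑-distrib-+ (λ b → adj′ a b + δ b a) (λ b → δ b (σ a))) ⟨
    ∑[ b < n ] (adj′ a b + δ b a + δ b (σ a)) + ∑[ b < n ] δ b (σ⁻¹ a)
      ≡⟨ ∑-distrib-+ (λ b → adj′ a b + δ b a + δ b (σ a)) (λ b → δ b (σ⁻¹ a)) ⟨
    ∑[ b < n ] (adj′ a b + δ b a + δ b (σ a) + δ b (σ⁻¹ a))
      ≡⟨ sum-cong-≗ (partition a) ⟩
    ∑[ b < n ] 1
      ≡⟨ ∑-const n 1 ⟩
    n * 1
      ≡⟨ *-identityʳ n ⟩
    n ∎
    where
    open ≡-Reasoning
    adj′ : Fin n → Fin n → ℕ
    adj′ a b = 𝟙 (complementAdj a b)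

  module _ {ℓ} {A : Set ℓ} (f : Fin n → A) (invariant : ∀ a → f (σ a) ≡ f a) where

    invariant⁻¹ : ∀ a → f (σ⁻¹ a) ≡ f a
    invariant⁻¹ a = trans (sym (invariant (σ⁻¹ a))) (cong f (inverseʳ π))

    adj-across-invariant : ∀ {a b} → f a ≢ f b → Adj a b
    adj-across-invariant {a} {b} fa≢fb =
      decidable-stable (T? _) λ ¬a~b → fa≢fb (sym (f-orbit (non-adjacent ¬a~b)))
      where
      f-orbit : b ≡ a ⊎ b ≡ σ a ⊎ b ≡ σ⁻¹ a → f b ≡ f a
      f-orbit (inj₁ refl)        = refl
      f-orbit (inj₂ (inj₁ refl)) = invariant a
      f-orbit (inj₂ (inj₂ refl)) = invariant⁻¹ a

    reach-via : ∀ {a b} w → f w ≢ f a → f w ≢ f b → Reach 2 a b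
    reach-via {a} w fw≢fa fw≢fb =
      reach-snoc (reach-snoc (reach-refl a) (adj-across-invariant (fw≢fa ∘ sym))) (adj-across-invariant fw≢fb)

    complement-diameter-two : (∀ a → ∃[ w ] f w ≢ f a) → ∀ a b → Reach 2 a b
    complement-diameter-two other a b with T? (complementAdj a b)
    ... | yes a~b = reach-weaken (reach-snoc (reach-refl a) a~b)
    ... | no ¬a~b with other a | non-adjacent {a} {b} ¬a~b
    ...   | _ , _      | inj₁ refl        = reach-mono z≤n (reach-refl a)
    ...   | w , fw≢fa | inj₂ (inj₁ refl) = reach-via w fw≢fa (λ eq → fw≢fa (trans eq (invariant a)))
    ...   | w , fw≢fa | inj₂ (inj₂ refl) = reach-via w fw≢fa (λ eq → fw≢fa (trans eq (invariant⁻¹ a)))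
-- The starlike tree S(2², 1^(m−2))

module StarTree (k : ℕ) where

  m N : ℕ
  m = 3 + k
  N = m + 3

  tree : Graph N
  tree = starTree m

  module Tree = Walks tree

  o x₁ x₂ : Fin N
  o  = zero
  x₁ = suc zero
  x₂ = suc (suc zero)

  data StarEdge : ℕ → ℕ → Set where
    o─x  : ∀ {b} → 1 ≤ b → b ≤ m → StarEdge 0 b
    x₁─y : StarEdge 1 (suc m)
    x₂─z : StarEdge 2 (suc (suc m))

  starEdge-view : ∀ a b → T (starEdge m a b) → StarEdge a b
  starEdge-view 0 (suc b) e = o─x (s≤s z≤n) (<ᵇ⇒< b m (T-∨-false e))
  starEdge-view 1 b       e = subst (StarEdge 1) (sym (≡ᵇ⇒≡ b (suc m) (T-∨-false e))) x₁─y
  starEdge-view 2 b       e = subst (StarEdge 2) (sym (≡ᵇ⇒≡ b (suc (suc m)) e)) x₂─z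

  starEdge⇒< : ∀ {a b} → StarEdge a b → a < b
  starEdge⇒< (o─x 1≤b _) = 1≤b
  starEdge⇒< x₁─y        = s≤s (s≤s z≤n)
  starEdge⇒< x₂─z        = s≤s (s≤s (s≤s z≤n))

  starEdge-intro : ∀ {a b} → StarEdge a b → T (starEdge m a b)
  starEdge-intro (o─x {suc b} _ b<m) = Equivalence.from T-∨ (inj₁ (<⇒<ᵇ b<m))
  starEdge-intro x₁─y               = Equivalence.from T-∨ (inj₁ (≡⇒≡ᵇ m m refl))
  starEdge-intro x₂─z               = ≡⇒≡ᵇ m m refl

  starEdge⇒adj : ∀ {u v} → StarEdge (toℕ u) (toℕ v) → Tree.Adj u v
  starEdge⇒adj {u} {v} e = Equivalence.from T-∧
    ( Equivalence.from T-∨ (inj₁ (starEdge-intro e))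
    , subst (T ∘ not) (sym (dec-false (toℕ u ≟ℕ toℕ v) (<⇒≢ (starEdge⇒< e)))) tt )

  data Position : ℕ → Set where
    o-pos : Position 0
    x-pos : ∀ {a} → 1 ≤ a → a ≤ m → Position a
    y-pos : Position (suc m)
    z-pos : Position (suc (suc m))

  position : ∀ {a} → a < N → Position a
  position {zero}  _   = o-pos
  position {suc a} a<N with <-cmp a m
  ... | tri< a<m _ _     = x-pos (s≤s z≤n) a<m
  ... | tri≈ _ refl _    = y-pos
  ... | tri> _ _ m<a with <-cmp a (suc m)
  ...   | tri< a<1+m _ _ = ⊥-elim (<⇒≱ m<a (≤-pred a<1+m))
  ...   | tri≈ _ refl _  = z-pos
  ...   | tri> _ _ 1+m<a = ⊥-elim (<⇒≱ a<N (subst (_≤ suc a) (+-comm 3 m) (s≤s 1+m<a)))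

  position′ : ∀ (v : Fin N) → Position (toℕ v)
  position′ v = position (toℕ<n v)

  reach-from-o : ∀ v → Tree.Reach 2 o v
  reach-from-o v = from (position′ v) refl
    where
    o─x₁ : Tree.Adj o x₁
    o─x₁ = starEdge⇒adj {o} {x₁} (o─x (s≤s z≤n) (s≤s z≤n))
    o─x₂ : Tree.Adj o x₂
    o─x₂ = starEdge⇒adj {o} {x₂} (o─x (s≤s z≤n) (s≤s (s≤s z≤n)))
    from : ∀ {a} → Position a → toℕ v ≡ a → Tree.Reach 2 o v
    from o-pos       v≡0  =
      Tree.reach-mono z≤n (subst (Tree.Reach 0 o) (toℕ-injective (sym v≡0)) (Tree.reach-refl o))
    from (x-pos p q) refl =
      Tree.reach-weaken (Tree.reach-snoc (Tree.reach-refl o) (starEdge⇒adj {o} {v} (o─x p q)))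
    from y-pos       v≡y  = Tree.reach-snoc {w = x₁} (Tree.reach-snoc (Tree.reach-refl o) o─x₁)
                                             (starEdge⇒adj (subst (StarEdge 1) (sym v≡y) x₁─y))
    from z-pos       v≡z  = Tree.reach-snoc {w = x₂} (Tree.reach-snoc (Tree.reach-refl o) o─x₂)
                                             (starEdge⇒adj (subst (StarEdge 2) (sym v≡z) x₂─z))

  outDegree : ℕ → ℕ
  outDegree a = ∑[ v < N ] 𝟙 (starEdge m a (toℕ v))

  4≤N : 4 ≤ N
  4≤N = s≤s (s≤s (s≤s (≤-trans (s≤s z≤n) (m≤n+m 3 k))))

  suc-m<N : suc m < N
  suc-m<N = subst (suc m <_) (+-comm 3 m) (s≤s (s≤s (n≤1+n m)))

  suc-suc-m<N : suc (suc m) < N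
  suc-suc-m<N = subst (suc (suc m) <_) (+-comm 3 m) ≤-refl

  outDegree-o : outDegree 0 ≡ m
  outDegree-o = trans
    (sum-cong-≗ {suc (suc (k + 3))} {x = λ v → 𝟙 ((toℕ v <ᵇ m) ∨ false)} (λ v → cong 𝟙 (∨-identityʳ _)))
    (∑-𝟙-<ᵇ m (≤-trans (≤-reflexive (+-comm 3 k)) (m≤n+m (k + 3) 2)))

  outDegree-x₁ : outDegree 1 ≡ 1
  outDegree-x₁ = trans
    (sum-cong-≗ {N} {x = λ v → 𝟙 ((toℕ v ≡ᵇ suc m) ∨ false)} (λ v → cong 𝟙 (∨-identityʳ _)))
    (∑-𝟙-≡ᵇ (suc m) suc-m<N)

  outDegree-x₂ : outDegree 2 ≡ 1
  outDegree-x₂ = ∑-𝟙-≡ᵇ (suc (suc m)) suc-suc-m<N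

  starEdge≡true⇒< : ∀ {a b} → starEdge m a b ≡ true → a < b
  starEdge≡true⇒< {a} {b} e = starEdge⇒< (starEdge-view a b (subst T (sym e) tt))

  oriented-starEdge : ∀ a b →
    ((starEdge m a b ∨ starEdge m b a) ∧ not (a ≡ᵇ b)) ∧ (a <ᵇ b) ≡ starEdge m a b
  oriented-starEdge a b with starEdge m a b in e₁ | starEdge m b a in e₂
  ... | true  | _
    rewrite dec-false (a ≟ℕ b) (<⇒≢ (starEdge≡true⇒< e₁)) | dec-true (a <? b) (starEdge≡true⇒< e₁) = refl
  ... | false | true
    rewrite dec-false (a <? b) (<⇒≯ (starEdge≡true⇒< e₂)) = ∧-zeroʳ _
  ... | false | false = refl

  edgeCount-tree : edgeCount tree ≡ m + 2
  edgeCount-tree = begin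
    edgeCount tree
      ≡⟨ Distance.edgeCount≡∑ tree ⟩
    ∑[ u < N ] ∑[ v < N ] 𝟙 (adj tree u v ∧ (toℕ u <ᵇ toℕ v))
      ≡⟨ sum-cong-≗ {N} oriented-sum ⟩
    ∑[ u < N ] outDegree (toℕ u)
      ≡⟨ cong (λ r → outDegree 0 + (outDegree 1 + (outDegree 2 + r))) outDegree-rest ⟩
    outDegree 0 + (outDegree 1 + (outDegree 2 + 0))
      ≡⟨ cong₂ (λ r s → r + (s + (outDegree 2 + 0))) outDegree-o outDegree-x₁ ⟩
    m + (1 + (outDegree 2 + 0))
      ≡⟨ cong (λ t → m + (1 + (t + 0))) outDegree-x₂ ⟩
    m + 2 ∎
    where
    open ≡-Reasoning
    oriented-sum : ∀ u → ∑[ v < N ] 𝟙 (adj tree u v ∧ (toℕ u <ᵇ toℕ v)) ≡ outDegree (toℕ u)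
    oriented-sum u = sum-cong-≗ {N} (λ v → cong 𝟙 (oriented-starEdge (toℕ u) (toℕ v)))
    outDegree-rest : ∑[ u < k + 3 ] outDegree (3 + toℕ u) ≡ 0
    outDegree-rest = ∑-zero {k + 3} {λ u → outDegree (3 + toℕ u)} (λ _ → ∑-zero {N} (λ _ → refl))

  isX : ℕ → Bool
  isX a = (1 ≤ᵇ a) ∧ (a ≤ᵇ m)

  isX-x : ∀ {a} → 1 ≤ a → a ≤ m → isX a ≡ true
  isX-x {suc a} _ a<m = Equivalence.to T-≡ (<⇒<ᵇ a<m)

  isX-y : isX (suc m) ≡ false
  isX-y = dec-false (m <? m) (n≮n m)

  isX-z : isX (suc (suc m)) ≡ false
  isX-z = dec-false (suc m <? m) (<⇒≯ (n<1+n m))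

  tree-edge : ∀ {u v} → Tree.Adj u v → StarEdge (toℕ u) (toℕ v) ⊎ StarEdge (toℕ v) (toℕ u)
  tree-edge {u} {v} u~v with Equivalence.to T-∨ (proj₁ (Equivalence.to T-∧ u~v))
  ... | inj₁ e = inj₁ (starEdge-view _ _ e)
  ... | inj₂ e = inj₂ (starEdge-view _ _ e)

  starEdge-isX : ∀ {a b} → StarEdge a b → isX a ≢ isX b
  starEdge-isX (o─x 1≤b b≤m) eq = 0≢1+n (cong 𝟙 (trans eq (isX-x 1≤b b≤m)))
  starEdge-isX x₁─y          eq = 1+n≢0 (cong 𝟙 (trans eq isX-y))
  starEdge-isX x₂─z          eq = 1+n≢0 (cong 𝟙 (trans eq isX-z))

module StarLowerBound (k : ℕ) (H : Graph (StarTree.N k)) (tree⊑H : StarTree.tree k ⊑ H)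
                    (balanced : DistanceBalanced H) where

  open StarTree k

  open Walks H
  open Distance H

  reach-to-o : ∀ u → Reach 2 u o
  reach-to-o u = reach-⊑ tree⊑H (Tree.reach-sym (reach-from-o u))

  connected : Connected
  connected u v =
    reach-mono 4≤N (reach-⊑ tree⊑H (Tree.reach-trans (Tree.reach-sym (reach-from-o u)) (reach-from-o v)))

  m≤deg-o : m ≤ deg o
  m≤deg-o = begin
    m       ≡⟨ outDegree-o ⟨
    outDegree 0   ≤⟨ ∑-mono-≤ (λ v → 𝟙-mono (o─v v)) ⟩
    deg o         ∎
    where
    open ≤-Reasoning
    o─v : ∀ v → T (starEdge m 0 (toℕ v)) → Adj o v
    o─v v e = tree⊑H o v (starEdge⇒adj {o} {v} (starEdge-view 0 (toℕ v) e))

  Tr-constant : ∀ v → Tr o ≡ Tr v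
  Tr-constant v = transmission-constant tree⊑H connected balanced (reach-from-o v)

  m≤deg : ∀ v → m ≤ deg v
  m≤deg v = +-cancelʳ-≤ 2 m (deg v) (+-cancelˡ-≤ (Tr o) (m + 2) (deg v + 2) (begin
    Tr o + (m + 2)      ≡⟨ +-assoc (Tr o) m 2 ⟨
    Tr o + m + 2        ≤⟨ +-monoˡ-≤ 2 (+-monoʳ-≤ (Tr o) m≤deg-o) ⟩
    Tr o + deg o + 2    ≤⟨ transmission-upper o reach-to-o ⟩
    2 * N               ≤⟨ transmission-lower connected v ⟩
    Tr v + deg v + 2    ≡⟨ cong (λ t → t + deg v + 2) (Tr-constant v) ⟨
    Tr o + deg v + 2    ≡⟨ +-assoc (Tr o) (deg v) 2 ⟩
    Tr o + (deg v + 2)  ∎))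
    where open ≤-Reasoning

  edges-lower : N * m ≤ 2 * edgeCount H
  edges-lower = begin
    N * m               ≡⟨ ∑-const N m ⟨
    ∑[ v < N ] m        ≤⟨ ∑-mono-≤ m≤deg ⟩
    ∑[ v < N ] deg v    ≡⟨ handshake ⟨
    2 * edgeCount H     ∎
    where open ≤-Reasoning

module StarUpperBound (k : ℕ) where

  open StarTree k

  -- Successor and predecessor on the cycles 0 → m+1 → m+2 → 0 (o y z) and 1 → 2 → … → m → 1 (the x_i).
  next prev : ℕ → ℕ
  next a = if a ≡ᵇ 0 then suc m else if a ≡ᵇ m then 1 else if a ≡ᵇ suc (suc m) then 0 else suc a
  prev a = if a ≡ᵇ 0 then suc (suc m) else if a ≡ᵇ 1 then m else if a ≡ᵇ suc m then 0 else pred a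

  private
    ≡ᵇ-false : ∀ {a b} → a ≢ b → (a ≡ᵇ b) ≡ false
    ≡ᵇ-false {a} {b} = dec-false (a ≟ℕ b)

    m<1+m : m < suc m
    m<1+m = n<1+n m

    m<2+m : m < suc (suc m)
    m<2+m = m<n⇒m<1+n m<1+m

  next-x : ∀ {a} → 1 ≤ a → a < m → next a ≡ suc a
  next-x {suc a} _ a<m
    rewrite ≡ᵇ-false (<⇒≢ a<m) | ≡ᵇ-false (<⇒≢ (m<n⇒m<1+n (m<n⇒m<1+n a<m))) = refl

  next-m : next m ≡ 1
  next-m rewrite ≡ᵇ-refl m = refl

  next-y : next (suc m) ≡ suc (suc m)
  next-y rewrite ≡ᵇ-false (>⇒≢ m<1+m) | ≡ᵇ-false (<⇒≢ (n<1+n (suc m))) = refl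

  next-z : next (suc (suc m)) ≡ 0
  next-z rewrite ≡ᵇ-false (>⇒≢ m<2+m) | ≡ᵇ-refl m = refl

  prev-x : ∀ {a} → 2 ≤ a → a ≤ m → prev a ≡ pred a
  prev-x {suc zero}    (s≤s ())
  prev-x {suc (suc a)} _ a≤m rewrite ≡ᵇ-false (<⇒≢ (s≤s a≤m)) = refl

  prev-y : prev (suc m) ≡ 0
  prev-y rewrite ≡ᵇ-refl m = refl

  prev-z : prev (suc (suc m)) ≡ suc m
  prev-z rewrite ≡ᵇ-false (>⇒≢ (n<1+n (suc m))) = refl

  next<N : ∀ {a} → Position a → next a < N
  next<N o-pos = suc-m<N
  next<N (x-pos {a} 1≤a a≤m) with m≤n⇒m<n∨m≡n a≤m
  ... | inj₁ a<m  = subst (_< N) (sym (next-x 1≤a a<m)) (<-trans (s≤s a<m) suc-m<N)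
  ... | inj₂ refl = subst (_< N) (sym next-m) (s≤s (s≤s z≤n))
  next<N y-pos = subst (_< N) (sym next-y) suc-suc-m<N
  next<N z-pos = subst (_< N) (sym next-z) (s≤s z≤n)

  prev<N : ∀ {a} → Position a → prev a < N
  prev<N o-pos = suc-suc-m<N
  prev<N (x-pos {a} 1≤a a≤m) with m≤n⇒m<n∨m≡n 1≤a
  ... | inj₁ 1<a  =
    subst (_< N) (sym (prev-x 1<a a≤m)) (≤-<-trans pred[n]≤n (≤-<-trans a≤m (<-trans m<1+m suc-m<N)))
  ... | inj₂ refl = <-trans m<1+m suc-m<N
  prev<N y-pos = subst (_< N) (sym prev-y) (s≤s z≤n)
  prev<N z-pos = subst (_< N) (sym prev-z) suc-m<N

  prev-next : ∀ {a} → Position a → prev (next a) ≡ a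
  prev-next o-pos = prev-y
  prev-next (x-pos {a} 1≤a a≤m) with m≤n⇒m<n∨m≡n a≤m
  ... | inj₁ a<m  = trans (cong prev (next-x 1≤a a<m)) (prev-x (s≤s 1≤a) a<m)
  ... | inj₂ refl = cong prev next-m
  prev-next y-pos = trans (cong prev next-y) prev-z
  prev-next z-pos = cong prev next-z

  next-prev : ∀ {a} → Position a → next (prev a) ≡ a
  next-prev o-pos = next-z
  next-prev (x-pos {suc a} 1≤a a≤m) with m≤n⇒m<n∨m≡n 1≤a
  ... | inj₁ 1<a  = trans (cong next (prev-x 1<a a≤m)) (next-x (≤-pred 1<a) a≤m)
  ... | inj₂ refl = next-m
  next-prev y-pos = cong next prev-y
  next-prev z-pos = trans (cong next prev-z) next-y

  next≢self : ∀ {a} → Position a → next a ≢ a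
  next≢self o-pos = λ ()
  next≢self (x-pos {a} 1≤a a≤m) with m≤n⇒m<n∨m≡n a≤m
  ... | inj₁ a<m  = λ eq → 1+n≢n (trans (sym (next-x 1≤a a<m)) eq)
  ... | inj₂ refl = λ eq → <⇒≢ (s≤s (s≤s z≤n)) (trans (sym next-m) eq)
  next≢self y-pos = λ eq → 1+n≢n (trans (sym next-y) eq)
  next≢self z-pos = λ eq → 0≢1+n (trans (sym next-z) eq)

  isX-next : ∀ {a} → Position a → isX (next a) ≡ isX a
  isX-next o-pos = isX-y
  isX-next (x-pos {a} 1≤a a≤m) with m≤n⇒m<n∨m≡n a≤m
  ... | inj₁ a<m  = trans (cong isX (next-x 1≤a a<m)) (trans (isX-x (s≤s z≤n) a<m) (sym (isX-x 1≤a a≤m)))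
  ... | inj₂ refl = trans (cong isX next-m) (sym (isX-x 1≤a ≤-refl))
  isX-next y-pos = trans (cong isX next-y) (trans isX-z (sym isX-y))
  isX-next z-pos = trans (cong isX next-z) (sym isX-z)

  next≢prev : ∀ {a} → Position a → next a ≢ prev a
  next≢prev o-pos = <⇒≢ (n<1+n (suc m))
  next≢prev (x-pos {a} 1≤a a≤m) with m≤n⇒m<n∨m≡n 1≤a | m≤n⇒m<n∨m≡n a≤m
  ... | inj₂ refl | _         = <⇒≢ (s≤s (s≤s (s≤s z≤n)))
  ... | inj₁ 1<a  | inj₁ a<m  = λ eq →
    <⇒≢ (s≤s pred[n]≤n) (sym (trans (sym (next-x 1≤a a<m)) (trans eq (prev-x 1<a a≤m))))
  ... | inj₁ 1<a  | inj₂ refl = λ eq →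
    0≢1+n (suc-injective (trans (sym next-m) (trans eq (prev-x 1<a ≤-refl))))
  next≢prev y-pos = λ eq → 1+n≢0 (trans (sym next-y) (trans eq prev-y))
  next≢prev z-pos = λ eq → 0≢1+n (trans (sym next-z) (trans eq prev-z))

  σ⁺ σ⁻ : Fin N → Fin N
  σ⁺ u = fromℕ< (next<N (position′ u))
  σ⁻ u = fromℕ< (prev<N (position′ u))

  toℕ-σ⁺ : ∀ u → toℕ (σ⁺ u) ≡ next (toℕ u)
  toℕ-σ⁺ u = toℕ-fromℕ< _

  toℕ-σ⁻ : ∀ u → toℕ (σ⁻ u) ≡ prev (toℕ u)
  toℕ-σ⁻ u = toℕ-fromℕ< _

  cycles : Permutation′ N
  cycles = permutation σ⁺ σ⁻
    (λ u → toℕ-injective (trans (toℕ-σ⁺ (σ⁻ u)) (trans (cong next (toℕ-σ⁻ u)) (next-prev (position′ u)))))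
    (λ u → toℕ-injective (trans (toℕ-σ⁻ (σ⁺ u)) (trans (cong prev (toℕ-σ⁺ u)) (prev-next (position′ u)))))

  open PermutationComplement cycles
    (λ u eq → next≢self (position′ u) (trans (sym (toℕ-σ⁺ u)) (cong toℕ eq)))
    (λ u eq → next≢prev (position′ u) (trans (sym (toℕ-σ⁺ u)) (trans (cong toℕ eq) (toℕ-σ⁻ u))))
    public

  isX-σ⁺ : ∀ u → isX (toℕ (σ⁺ u)) ≡ isX (toℕ u)
  isX-σ⁺ u = trans (cong isX (toℕ-σ⁺ u)) (isX-next (position′ u))

  tree⊑complement : tree ⊑ complement
  tree⊑complement u v u~v with tree-edge {u} {v} u~v
  ... | inj₁ e = adj-across-invariant (isX ∘ toℕ) isX-σ⁺ {u} {v} (starEdge-isX e)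
  ... | inj₂ e = adj-across-invariant (isX ∘ toℕ) isX-σ⁺ {u} {v} (starEdge-isX e ∘ sym)

  complement-regular : ∀ v → Distance.deg complement v ≡ m
  complement-regular v = +-cancelʳ-≡ 3 _ m (deg-complement v)

  complement-diameter : ∀ u v → Walks.Reach complement 2 u v
  complement-diameter = complement-diameter-two (isX ∘ toℕ) isX-σ⁺ other-class
    where
    other-class : ∀ u → ∃[ w ] isX (toℕ w) ≢ isX (toℕ u)
    other-class u with isX (toℕ u)
    ... | true  = o  , λ ()
    ... | false = x₁ , λ ()

  complement-balanced : DistanceBalanced complement
  complement-balanced =
    diameter-two-regular⇒balanced complement (s≤s (s≤s z≤n)) complement-diameter complement-regular

  edges-complement : 2 * edgeCount complement ≡ N * m
  edges-complement = trans (Distance.handshake complement) (trans (sum-cong-≗ complement-regular) (∑-const N m))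

half-≤ : ∀ c x e → 2 * c + x ≤ 2 * e → c + x / 2 ≤ e
half-≤ c x e h = *-cancelˡ-≤ 2 (begin
  2 * (c + x / 2)      ≡⟨ *-distribˡ-+ 2 c (x / 2) ⟩
  2 * c + 2 * (x / 2)  ≤⟨ +-monoʳ-≤ (2 * c) (≤-trans (≤-reflexive (*-comm 2 (x / 2))) (m/n*n≤m x 2)) ⟩
  2 * c + x            ≤⟨ h ⟩
  2 * e                ∎)
  where open ≤-Reasoning

half-≡ : ∀ c x e → 2 * c + x ≡ 2 * e → c + x / 2 ≡ e
half-≡ c x e h = begin
  c + x / 2                ≡⟨ cong (λ y → c + y / 2) x≡2[e∸c] ⟩
  c + 2 * (e ∸ c) / 2      ≡⟨ cong (c +_) (m*n/n≡m′ (e ∸ c)) ⟩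
  c + (e ∸ c)              ≡⟨ m+[n∸m]≡n c≤e ⟩
  e                        ∎
  where
  open ≡-Reasoning
  c≤e : c ≤ e
  c≤e = *-cancelˡ-≤ 2 (≤-trans (m≤m+n (2 * c) x) (≤-reflexive h))
  x≡2[e∸c] : x ≡ 2 * (e ∸ c)
  x≡2[e∸c] = +-cancelˡ-≡ (2 * c) x (2 * (e ∸ c))
    (trans h (trans (cong (2 *_) (sym (m+[n∸m]≡n c≤e))) (*-distribˡ-+ 2 c (e ∸ c))))
  m*n/n≡m′ : ∀ y → 2 * y / 2 ≡ y
  m*n/n≡m′ y = trans (cong (_/ 2) (*-comm 2 y)) (m*n/n≡m y 2)

star-count-identity : ∀ k → let m = 3 + k in 2 * (m + 2) + (m * m + m ∸ 4) ≡ (m + 3) * m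
star-count-identity k = begin
  2 * (m + 2) + (m * m + m ∸ 4)        ≡⟨ cong (λ y → 2 * (m + 2) + (y ∸ 4)) (expand k) ⟩
  2 * (m + 2) + (4 + r ∸ 4)            ≡⟨ cong (2 * (m + 2) +_) (m+n∸m≡n 4 r) ⟩
  2 * (m + 2) + r                      ≡⟨ collect k ⟩
  (m + 3) * m                          ∎
  where
  open ≡-Reasoning
  m r : ℕ
  m = 3 + k
  r = 8 + 7 * k + k * k
  expand : ∀ k → (3 + k) * (3 + k) + (3 + k) ≡ 4 + (8 + 7 * k + k * k)
  expand = solve-∀
  collect : ∀ k → 2 * ((3 + k) + 2) + (8 + 7 * k + k * k) ≡ ((3 + k) + 3) * (3 + k)
  collect = solve-∀

theorem4p2 : (m : ℕ) → 3 ≤ m →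
    (Σ (Graph (m + 3)) λ H → starTree m ⊑ H × DistanceBalanced H
       × edgeCount H ≡ edgeCount (starTree m) + (m * m + m ∸ 4) / 2)
    × ((H : Graph (m + 3)) → starTree m ⊑ H → DistanceBalanced H →
       edgeCount (starTree m) + (m * m + m ∸ 4) / 2 ≤ edgeCount H)
theorem4p2 (suc (suc (suc k))) (s≤s (s≤s (s≤s z≤n))) =
  ( complement , tree⊑complement , complement-balanced
  , sym (half-≡ (edgeCount tree) surplus (edgeCount complement) (trans target (sym edges-complement))) )
  , λ H tree⊑H balanced →
      half-≤ (edgeCount tree) surplus (edgeCount H)
             (≤-trans (≤-reflexive target) (StarLowerBound.edges-lower k H tree⊑H balanced))
  where
  open StarTree k
  open StarUpperBound k
  surplus : ℕ
  surplus = m * m + m ∸ 4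
  target : 2 * edgeCount tree + surplus ≡ N * m
  target = trans (cong (λ e → 2 * e + surplus) edgeCount-tree) (star-count-identity k)
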